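{- Let $K=\mathbb{Q}(\sqrt{ -3})$, $\mathcal{O}_K=\mathbb{Z}[\tfrac{1+\sqrt{ -3}}{2}]$, and $\mathfrak{f}=4\sqrt{ -3}\,\mathcal{O}_K$. For a nonzero ideal $\mathfrak{a}$ of $\mathcal{O}_K$ coprime to $\mathfrak{f}$, let $\alpha$ be its unique generator of the form $\alpha=x+y\sqrt{ -3}$ with $x,y\in\mathbb{Z}$, $x+y\equiv 1\pmod 2$, $x\equiv 1\pmod 3$, and set $c_{\pm}(\mathfrak{a})=(-1)^{(x\mp y-1)/2}\alpha^6$; set $c_\pm(\mathfrak{a})=0$ if $\mathfrak{a}$ is not coprime to $\mathfrak{f}$. For $n\ge1$ let $a_\pm(n)=\sum_{\mathrm{Norm}(\mathfrak{a})=n}c_\pm(\mathfrak{a})$, the sum over nonzero ideals of norm $n$; these are the Fourier coefficients of the normalised Hecke eigenforms $\varphi_{K,c_\pm}\in S_7(\Gamma_1(144),\chi)$, where $\chi(n)=(-1)^{(n-1)/2}$ if $\gcd(n,144)=1$ and $\chi(n)=0$ otherwise. If $p$ is a prime with $p\equiv 1\pmod{12}$ and $j\ge0$ is an integer, then $a_+(p^j)=a_-(p^j)$, and this common value is $\equiv 1\pmod 2$ if $j$ is even and $\equiv 0\pmod 2$ if $j$ is odd. -}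

module Defs where

open import Data.Nat as ℕ using (ℕ; zero; suc)
open import Data.Integer as ℤ using (ℤ; +_; -[1+_])
open import Data.Integer.DivMod using (_/_; _%_)
open import Data.List using (List; []; _∷_; map; upTo; _++_; concatMap; filter; foldr)
open import Data.Product using (_×_; _,_)
open import Data.Bool using (Bool; true; false; if_then_else_)
open import Relation.Nullary.Decidable using (_×-dec_; ⌊_⌋)
open import Relation.Binary.PropositionalEquality using (_≡_)

-- mk u v represents u + v·√-3; elements of ℤ[√-3] ⊂ O_K, with u v : ℤ.
record ℤ√-3 : Set where
  constructor mk
  field
    re : ℤ
    im : ℤ
open ℤ√-3 public

infixl 6 _⊕_
infixl 7 _⊗_

_⊕_ : ℤ√-3 → ℤ√-3 → ℤ√-3
mk a b ⊕ mk c d = mk (a ℤ.+ c) (b ℤ.+ d)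

_⊗_ : ℤ√-3 → ℤ√-3 → ℤ√-3
mk a b ⊗ mk c d =
  mk (a ℤ.* c ℤ.- + 3 ℤ.* b ℤ.* d) (a ℤ.* d ℤ.+ b ℤ.* c)

𝟘 𝟙 : ℤ√-3
𝟘 = mk (+ 0) (+ 0)
𝟙 = mk (+ 1) (+ 0)

_^ᶻ_ : ℤ√-3 → ℕ → ℤ√-3
z ^ᶻ zero  = 𝟙
z ^ᶻ suc k = z ⊗ (z ^ᶻ k)

_·_ : ℤ → ℤ√-3 → ℤ√-3
s · mk a b = mk (s ℤ.* a) (s ℤ.* b)

negOnePow : ℤ → ℤ
negOnePow k with k % + 2
... | 0 = + 1
... | _ = ℤ.- + 1

norm : ℤ → ℤ → ℤ
norm x y = x ℤ.* x ℤ.+ + 3 ℤ.* y ℤ.* y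

-- (x, y) is the normalised generator x + y√-3 of an ideal of norm n
-- coprime to f = 4√-3: x² + 3y² = n, x + y ≡ 1 (mod 2), x ≡ 1 (mod 3).
NormGen : ℕ → ℤ × ℤ → Set
NormGen n (x , y) = (norm x y ≡ + n) × (((x ℤ.+ y) % + 2 ≡ 1) × (x % + 3 ≡ 1))

normGen? : ∀ n p → Relation.Nullary.Decidable.Dec (NormGen n p)
normGen? n (x , y) =
  (norm x y ℤ.≟ + n) ×-dec (((x ℤ.+ y) % + 2 ℕ.≟ 1) ×-dec (x % + 3 ℕ.≟ 1))
  where import Relation.Nullary.Decidable

range : ℕ → List ℤ
range n = map +_ (upTo (suc n)) ++ map -[1+_] (upTo n)

-- all (x, y) with |x|, |y| ≤ n; every generator of norm n lies here
candidates : ℕ → List (ℤ × ℤ)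
candidates n = concatMap (λ x → map (λ y → x , y) (range n)) (range n)

-- normalised generators of the nonzero ideals of norm n coprime to f
-- (one per ideal)
normGens : ℕ → List (ℤ × ℤ)
normGens n = filter (normGen? n) (candidates n)

data Sign : Set where
  plus minus : Sign

-- x ∓ y  (minus for c₊, plus for c₋)
mp : Sign → ℤ → ℤ → ℤ
mp plus  x y = x ℤ.- y
mp minus x y = x ℤ.+ y

c : Sign → ℤ × ℤ → ℤ√-3
c s (x , y) = negOnePow ((mp s x y ℤ.- + 1) / + 2) · (mk x y ^ᶻ 6)

-- a±(n) = Σ_{Norm 𝔞 = n} c±(𝔞); ideals not coprime to f contribute 0
a : Sign → ℕ → ℤ√-3
a s n = foldr (λ p acc → c s p ⊕ acc) 𝟘 (normGens n)

-- congruence modulo 2·O_K for elements of ℤ[√-3]: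
-- u + v√-3 ∈ 2·O_K  ⇔  (u + v√-3)/2 ∈ O_K = {(a + b√-3)/2 : a ≡ b mod 2}
--                    ⇔  u ≡ v (mod 2)
InTwoOK : ℤ√-3 → Set
InTwoOK (mk u v) = (u ℤ.- v) % + 2 ≡ 0

_≡_[mod2] : ℤ√-3 → ℤ√-3 → Set
z ≡ w [mod2] = InTwoOK ((z ⊕ (ℤ.- + 1) · w))

{-# OPTIONS --safe #-}
-- Reduction modulo 2O_K sends u + v√-3 to u + v mod 2, a ring homomorphism ℤ[√-3] → 𝔽₂. A
-- normalised generator x + y√-3 has x + y odd, so every c±(𝔞) reduces to 1 and a±(n) reduces to
-- the number of normalised generators of norm n. The conjugation y ↦ -y pairs these off except
-- those with y = 0, i.e. x² = n with x odd and x ≡ 1 (mod 3); for n = p ^ j with p ≡ 1 (mod 12)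
-- this leaves x = p ^ (j / 2) if j is even and nothing if j is odd.
-- For a₊ = a₋: as p ^ j ≡ 1 (mod 4), x² + 3y² = p ^ j forces y even, so (x - y - 1)/2 and
-- (x + y - 1)/2 differ by the even number y and the two signs agree.
module Submission where

open import Defs
open import Data.Bool using (Bool; true; false; _xor_; _∧_; if_then_else_)
open import Data.Bool.Properties using (xor-assoc; xor-same; xor-identityʳ)
open import Data.Integer as ℤ using (ℤ; +_; -[1+_]; ∣_∣; _+_; _*_; _-_; -_)
import Data.Integer.Properties as ℤP
open import Algebra.Properties.AbelianGroup ℤP.+-0-abelianGroup using (∙-cancelʳ)
open import Data.Integer.DivMod using (a≡a%n+[a/n]*n; n%d<d)
open import Data.Integer.Tactic.RingSolver using (solve-∀)
open import Data.List using (List; []; _∷_; map; upTo; _++_; concatMap; filter; foldr)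
open import Data.List.Properties using (map-upTo)
open import Data.List.Relation.Unary.All as All using (All; []; _∷_)
open import Data.List.Relation.Unary.All.Properties using (all-filter)
open import Data.Nat as ℕ using (ℕ; zero; suc; _^_; _%_; _/_; s≤s; z<s; s<s)
import Data.Nat.Properties as ℕP
open import Data.Nat.DivMod
  using (m≡m%n+[m/n]*n; m%n<n; m<n⇒m%n≡m; %-distribˡ-*; m∣n⇒o%n%m≡o%m; m*n%n≡0)
open import Data.Nat.Divisibility using (_∣_; divides)
open import Data.Nat.Primality using (Prime; euclidsLemma; ¬prime[1]; prime⇒nonZero)
import Data.Nat.Tactic.RingSolver as ℕ-Solver
open import Data.Product using (_×_; _,_; proj₁; proj₂; ∃-syntax)
open import Data.Sum using (reduce)
open import Function using (_∘_; _⇔_; mk⇔)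
open import Level using (0ℓ)
open import Relation.Binary.Definitions using (tri<; tri≈; tri>)
open import Relation.Binary.PropositionalEquality
open import Relation.Nullary using (¬_; does; yes; no; contradiction)
open import Relation.Nullary.Decidable using (dec-true; dec-false; does-⇔)
open import Relation.Unary using (Pred; Decidable)

private
  variable
    A B : Set
    n p j : ℕ

quotient-mono : ∀ {d r r′} {q q′ : ℤ} → r ℕ.< d → q ℤ.< q′ →
                + r + q * + d ℤ.< + r′ + q′ * + d
quotient-mono {d} {r} {r′} {q} {q′} r<d q<q′ = begin-strict
  + r + q * + d    <⟨ ℤP.+-monoˡ-< (q * + d) (ℤ.+<+ r<d) ⟩
  + d + q * + d    ≡⟨ ℤP.suc-* q (+ d) ⟨
  ℤ.suc q * + d    ≤⟨ ℤP.*-monoʳ-≤-nonNeg (+ d) (ℤP.i<j⇒suc[i]≤j q<q′) ⟩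
  q′ * + d         ≤⟨ ℤP.i≤j+i (q′ * + d) (+ r′) ⟩
  + r′ + q′ * + d  ∎
  where open ℤP.≤-Reasoning

quotient-unique : ∀ {d r r′} {q q′ : ℤ} → r ℕ.< d → r′ ℕ.< d →
                  + r + q * + d ≡ + r′ + q′ * + d → q ≡ q′
quotient-unique {q = q} {q′} r<d r′<d eq with ℤP.<-cmp q q′
... | tri< q<q′ _ _ = contradiction (quotient-mono r<d q<q′) (ℤP.<-irrefl eq)
... | tri≈ _ q≡q′ _ = q≡q′
... | tri> _ _ q′<q = contradiction (quotient-mono r′<d q′<q) (ℤP.<-irrefl (sym eq))

divMod-unique : ∀ {d} .{{_ : ℕ.NonZero d}} {a q : ℤ} {r} → r ℕ.< d → a ≡ + r + q * + d →
                a ℤ.% + d ≡ r × a ℤ./ + d ≡ q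
divMod-unique {d} {a} {q} {r} r<d a≡r+qd = a%d≡r , a/d≡q
  where
  euclid : + (a ℤ.% + d) + (a ℤ./ + d) * + d ≡ + r + q * + d
  euclid = trans (sym (a≡a%n+[a/n]*n a (+ d))) a≡r+qd
  a/d≡q : a ℤ./ + d ≡ q
  a/d≡q = quotient-unique (n%d<d a (+ d)) r<d euclid
  a%d≡r : a ℤ.% + d ≡ r
  a%d≡r = ℤP.+-injective (∙-cancelʳ (q * + d) (+ (a ℤ.% + d)) (+ r)
            (subst (λ q₀ → + (a ℤ.% + d) + q₀ * + d ≡ + r + q * + d) a/d≡q euclid))

bit : Bool → ℕ
bit false = 0
bit true  = 1

parity : ℤ → Bool
parity a = a ℤ.% + 2 ℕ.≡ᵇ 1

parity-bit+q*2 : ∀ b q → parity (+ bit b + q * + 2) ≡ b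
parity-bit+q*2 false q = cong (ℕ._≡ᵇ 1) (proj₁ (divMod-unique {q = q} z<s refl))
parity-bit+q*2 true  q = cong (ℕ._≡ᵇ 1) (proj₁ (divMod-unique {q = q} (s<s z<s) refl))

parity-split : ∀ a {b} → parity a ≡ b → a ≡ + bit b + (a ℤ./ + 2) * + 2
parity-split a refl with a ℤ.% + 2 | a≡a%n+[a/n]*n a (+ 2) | n%d<d a (+ 2)
... | 0           | a≡ | _ = a≡
... | 1           | a≡ | _ = a≡
... | suc (suc _) | _  | s<s (s<s ())

%2≡bit-parity : ∀ a → a ℤ.% + 2 ≡ bit (parity a)
%2≡bit-parity a = proj₁ (divMod-unique {q = a ℤ./ + 2} (bit<2 (parity a)) (parity-split a refl))
  where
  bit<2 : ∀ b → bit b ℕ.< 2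
  bit<2 false = z<s
  bit<2 true  = s<s z<s

parity-+q*2 : ∀ a q → parity (a + q * + 2) ≡ parity a
parity-+q*2 a q = begin
  parity (a + q * + 2)
    ≡⟨ cong (λ a → parity (a + q * + 2)) (parity-split a refl) ⟩
  parity (+ bit (parity a) + (a ℤ./ + 2) * + 2 + q * + 2)
    ≡⟨ cong parity (regroup (+ bit (parity a)) (a ℤ./ + 2) q) ⟩
  parity (+ bit (parity a) + (a ℤ./ + 2 + q) * + 2)
    ≡⟨ parity-bit+q*2 (parity a) (a ℤ./ + 2 + q) ⟩
  parity a ∎
  where
  open ≡-Reasoning
  regroup : ∀ r s t → r + s * + 2 + t * + 2 ≡ r + (s + t) * + 2
  regroup = solve-∀

parity-+ : ∀ a b → parity (a + b) ≡ parity a xor parity b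
parity-+ a b = begin
  parity (a + b)
    ≡⟨ cong parity (cong₂ _+_ (parity-split a refl) (parity-split b refl)) ⟩
  parity ((+ bit α + qa * + 2) + (+ bit β + qb * + 2))
    ≡⟨ cong parity (regroup (+ bit α) (+ bit β) qa qb) ⟩
  parity (+ bit α + + bit β + (qa + qb) * + 2)
    ≡⟨ parity-+q*2 (+ bit α + + bit β) (qa + qb) ⟩
  parity (+ bit α + + bit β)
    ≡⟨ bits α β ⟩
  α xor β ∎
  where
  open ≡-Reasoning
  α = parity a
  β = parity b
  qa = a ℤ./ + 2
  qb = b ℤ./ + 2
  regroup : ∀ r s t u → (r + t * + 2) + (s + u * + 2) ≡ r + s + (t + u) * + 2
  regroup = solve-∀
  bits : ∀ c d → parity (+ bit c + + bit d) ≡ c xor d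
  bits false false = refl
  bits false true  = refl
  bits true  false = refl
  bits true  true  = refl

parity-* : ∀ a b → parity (a * b) ≡ parity a ∧ parity b
parity-* a b = begin
  parity (a * b)
    ≡⟨ cong parity (cong₂ _*_ (parity-split a refl) (parity-split b refl)) ⟩
  parity ((+ bit α + qa * + 2) * (+ bit β + qb * + 2))
    ≡⟨ cong parity (regroup (+ bit α) (+ bit β) qa qb) ⟩
  parity (+ bit α * + bit β + q * + 2)
    ≡⟨ parity-+q*2 (+ bit α * + bit β) q ⟩
  parity (+ bit α * + bit β)
    ≡⟨ bits α β ⟩
  α ∧ β ∎
  where
  open ≡-Reasoning
  α = parity a
  β = parity b
  qa = a ℤ./ + 2
  qb = b ℤ./ + 2
  q = qa * + bit β + + bit α * qb + qa * qb * + 2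
  regroup : ∀ r s t u → (r + t * + 2) * (s + u * + 2) ≡ r * s + (t * s + r * u + t * u * + 2) * + 2
  regroup = solve-∀
  bits : ∀ c d → parity (+ bit c * + bit d) ≡ c ∧ d
  bits false false = refl
  bits false true  = refl
  bits true  false = refl
  bits true  true  = refl

negOnePow-parity : ∀ k → negOnePow k ≡ (if parity k then - + 1 else + 1)
negOnePow-parity k with k ℤ.% + 2 | n%d<d k (+ 2)
... | 0           | _ = refl
... | 1           | _ = refl
... | suc (suc _) | s<s (s<s ())

negOnePow-cong : ∀ k k′ → parity k ≡ parity k′ → negOnePow k ≡ negOnePow k′
negOnePow-cong k k′ eq = begin
  negOnePow k                         ≡⟨ negOnePow-parity k ⟩
  (if parity k then - + 1 else + 1)   ≡⟨ cong (λ b → if b then - + 1 else + 1) eq ⟩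
  (if parity k′ then - + 1 else + 1)  ≡⟨ negOnePow-parity k′ ⟨
  negOnePow k′                        ∎
  where open ≡-Reasoning

parity-negOnePow : ∀ k → parity (negOnePow k) ≡ true
parity-negOnePow k rewrite negOnePow-parity k with parity k
... | false = refl
... | true  = refl

-- Reduction modulo 2O_K

-- 𝔽₂ is encoded as (Bool, xor, ∧), with true = 1.
residue : ℤ√-3 → Bool
residue (mk u v) = parity (u + v)

residue-⊕ : ∀ z w → residue (z ⊕ w) ≡ residue z xor residue w
residue-⊕ (mk a b) (mk c d) = trans (cong parity (regroup a b c d)) (parity-+ (a + b) (c + d))
  where
  regroup : ∀ a b c d → (a + c) + (b + d) ≡ (a + b) + (c + d)
  regroup = solve-∀

residue-⊗ : ∀ z w → residue (z ⊗ w) ≡ residue z ∧ residue w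
residue-⊗ (mk a b) (mk c d) = begin
  parity ((a * c - + 3 * b * d) + (a * d + b * c))
    ≡⟨ cong parity (regroup a b c d) ⟩
  parity ((a + b) * (c + d) + (- (b * d * + 2)) * + 2)
    ≡⟨ parity-+q*2 ((a + b) * (c + d)) (- (b * d * + 2)) ⟩
  parity ((a + b) * (c + d))
    ≡⟨ parity-* (a + b) (c + d) ⟩
  parity (a + b) ∧ parity (c + d) ∎
  where
  open ≡-Reasoning
  regroup : ∀ a b c d →
            (a * c - + 3 * b * d) + (a * d + b * c) ≡ (a + b) * (c + d) + (- (b * d * + 2)) * + 2
  regroup = solve-∀

residue-· : ∀ s z → residue (s · z) ≡ parity s ∧ residue z
residue-· s (mk a b) = trans (cong parity (sym (ℤP.*-distribˡ-+ s a b))) (parity-* s (a + b))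

residue-^ᶻ : ∀ {z} → residue z ≡ true → ∀ k → residue (z ^ᶻ k) ≡ true
residue-^ᶻ z-odd zero    = refl
residue-^ᶻ {z} z-odd (suc k) =
  trans (residue-⊗ z (z ^ᶻ k)) (cong₂ _∧_ z-odd (residue-^ᶻ z-odd k))

residue⇒≡[mod2] : ∀ {z w} → residue z ≡ residue w → z ≡ w [mod2]
residue⇒≡[mod2] {mk u v} {mk u′ v′} eq =
  trans (%2≡bit-parity ((u + - + 1 * u′) - (v + - + 1 * v′))) (cong bit (begin
  parity ((u + - + 1 * u′) - (v + - + 1 * v′))
    ≡⟨ cong parity (regroup u v u′ v′) ⟩
  parity ((u + v) + (u′ + v′) + (- (v + u′)) * + 2)
    ≡⟨ parity-+q*2 ((u + v) + (u′ + v′)) (- (v + u′)) ⟩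
  parity ((u + v) + (u′ + v′))
    ≡⟨ parity-+ (u + v) (u′ + v′) ⟩
  parity (u + v) xor parity (u′ + v′)
    ≡⟨ cong (_xor parity (u′ + v′)) eq ⟩
  parity (u′ + v′) xor parity (u′ + v′)
    ≡⟨ xor-same (parity (u′ + v′)) ⟩
  false ∎))
  where
  open ≡-Reasoning
  regroup : ∀ u v u′ v′ →
            (u + - + 1 * u′) - (v + - + 1 * v′) ≡ (u + v) + (u′ + v′) + (- (v + u′)) * + 2
  regroup = solve-∀

residue-c : ∀ s {n g} → NormGen n g → residue (c s g) ≡ true
residue-c s {g = x , y} (_ , x+y-odd , _) =
  trans (residue-· (negOnePow k) (mk x y ^ᶻ 6))
        (cong₂ _∧_ (parity-negOnePow k) (residue-^ᶻ {mk x y} (cong (ℕ._≡ᵇ 1) x+y-odd) 6))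
  where
  k = (mp s x y - + 1) ℤ./ + 2

NormGen-conj : ∀ {n x y} → NormGen n (x , y) → NormGen n (x , - y)
NormGen-conj {n} {x} {y} (norm≡n , x+y-odd , x≡1) =
  trans (same-norm x y) norm≡n , x-y-odd , x≡1
  where
  same-norm : ∀ x y → x * x + + 3 * (- y) * (- y) ≡ x * x + + 3 * y * y
  same-norm = solve-∀
  shift : ∀ x y → x + y ≡ (x + - y) + y * + 2
  shift = solve-∀
  x-y-odd : (x + - y) ℤ.% + 2 ≡ 1
  x-y-odd = begin
    (x + - y) ℤ.% + 2                 ≡⟨ %2≡bit-parity (x + - y) ⟩
    bit (parity (x + - y))            ≡⟨ cong bit (parity-+q*2 (x + - y) y) ⟨
    bit (parity (x + - y + y * + 2))  ≡⟨ cong (bit ∘ parity) (shift x y) ⟨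
    bit (parity (x + y))              ≡⟨ cong (bit ∘ (ℕ._≡ᵇ 1)) x+y-odd ⟩
    1                                 ∎
    where open ≡-Reasoning

norm-even-odd : ∀ x y → parity x ≡ false → parity y ≡ true → norm x y ℤ.% + 4 ≡ 3
norm-even-odd x y x-even y-odd = proj₁ (divMod-unique {q = q} (s<s (s<s (s<s z<s))) (begin
  norm x y
    ≡⟨ cong₂ norm (parity-split x x-even) (parity-split y y-odd) ⟩
  norm (+ 0 + qx * + 2) (+ 1 + qy * + 2)
    ≡⟨ expand qx qy ⟩
  + 3 + q * + 4 ∎))
  where
  open ≡-Reasoning
  qx = x ℤ./ + 2
  qy = y ℤ./ + 2
  q = qx * qx + + 3 * qy * qy + + 3 * qy
  expand : ∀ s t → (+ 0 + s * + 2) * (+ 0 + s * + 2) + + 3 * (+ 1 + t * + 2) * (+ 1 + t * + 2)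
                   ≡ + 3 + (s * s + + 3 * t * t + + 3 * t) * + 4
  expand = solve-∀

NormGen⇒odd-even : ∀ {n x y} → n % 4 ≡ 1 → NormGen n (x , y) →
                   parity x ≡ true × parity y ≡ false
NormGen⇒odd-even {n} {x} {y} n≡1 (norm≡n , x+y-odd , _)
  with parity x in x-parity | parity y in y-parity
     | trans (sym (parity-+ x y)) (cong (ℕ._≡ᵇ 1) x+y-odd)
... | true  | false | _  = refl , refl
... | true  | true  | ()
... | false | false | ()
... | false | true  | _  = contradiction (trans (sym n≡1) n≡3) λ ()
  where
  n≡3 : n % 4 ≡ 3
  n≡3 = trans (cong (ℤ._% + 4) (sym norm≡n)) (norm-even-odd x y x-parity y-parity)

c-plus≡c-minus : ∀ {n g} → n % 4 ≡ 1 → NormGen n g → c plus g ≡ c minus g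
c-plus≡c-minus {n} {x , y} n≡1 g =
  cong (_· (mk x y ^ᶻ 6)) (negOnePow-cong ((x - y - + 1) ℤ./ + 2) ((x + y - + 1) ℤ./ + 2) (begin
    parity ((x - y - + 1) ℤ./ + 2)  ≡⟨ cong parity (half (qx - qy) x-y-1≡) ⟩
    parity (qx - qy)               ≡⟨ parity-+q*2 (qx - qy) qy ⟨
    parity (qx - qy + qy * + 2)    ≡⟨ cong parity (shift qx qy) ⟩
    parity (qx + qy)               ≡⟨ cong parity (half (qx + qy) x+y-1≡) ⟨
    parity ((x + y - + 1) ℤ./ + 2) ∎))
  where
  open ≡-Reasoning
  qx = x ℤ./ + 2
  qy = y ℤ./ + 2
  x≡ : x ≡ + 1 + qx * + 2
  x≡ = parity-split x (proj₁ (NormGen⇒odd-even {n} {x} {y} n≡1 g))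
  y≡ : y ≡ + 0 + qy * + 2
  y≡ = parity-split y (proj₂ (NormGen⇒odd-even {n} {x} {y} n≡1 g))
  half : ∀ {a} q → a ≡ + 0 + q * + 2 → a ℤ./ + 2 ≡ q
  half q a≡ = proj₂ (divMod-unique {q = q} z<s a≡)
  diff : ∀ s t → (+ 1 + s * + 2) - (+ 0 + t * + 2) - + 1 ≡ + 0 + (s - t) * + 2
  diff = solve-∀
  add : ∀ s t → (+ 1 + s * + 2) + (+ 0 + t * + 2) - + 1 ≡ + 0 + (s + t) * + 2
  add = solve-∀
  shift : ∀ s t → s - t + t * + 2 ≡ s + t
  shift = solve-∀
  x-y-1≡ : x - y - + 1 ≡ + 0 + (qx - qy) * + 2
  x-y-1≡ = trans (cong₂ (λ x y → x - y - + 1) x≡ y≡) (diff qx qy)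
  x+y-1≡ : x + y - + 1 ≡ + 0 + (qx + qy) * + 2
  x+y-1≡ = trans (cong₂ (λ x y → x + y - + 1) x≡ y≡) (add qx qy)

-- Counting modulo 2

oddCount : {P : Pred A 0ℓ} → Decidable P → List A → Bool
oddCount P? = foldr (λ x b → does (P? x) xor b) false

module _ {P : Pred A 0ℓ} (P? : Decidable P) where

  oddCount-++ : ∀ xs ys → oddCount P? (xs ++ ys) ≡ oddCount P? xs xor oddCount P? ys
  oddCount-++ []       ys = refl
  oddCount-++ (x ∷ xs) ys =
    trans (cong (does (P? x) xor_) (oddCount-++ xs ys)) (sym (xor-assoc (does (P? x)) _ _))

  oddCount-map : ∀ (f : B → A) xs → oddCount P? (map f xs) ≡ oddCount (P? ∘ f) xs
  oddCount-map f []       = refl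
  oddCount-map f (x ∷ xs) = cong (does (P? (f x)) xor_) (oddCount-map f xs)

  oddCount-none : (∀ x → ¬ P x) → ∀ xs → oddCount P? xs ≡ false
  oddCount-none ¬P []       = refl
  oddCount-none ¬P (x ∷ xs) = cong₂ _xor_ (dec-false (P? x) (¬P x)) (oddCount-none ¬P xs)

  oddCount-concatMap : ∀ {Q : Pred B 0ℓ} (Q? : Decidable Q) {f : B → List A} →
                       (∀ x → oddCount P? (f x) ≡ does (Q? x)) →
                       ∀ xs → oddCount P? (concatMap f xs) ≡ oddCount Q? xs
  oddCount-concatMap Q? rows []       = refl
  oddCount-concatMap Q? {f} rows (x ∷ xs) =
    trans (oddCount-++ (f x) (concatMap f xs))
          (cong₂ _xor_ (rows x) (oddCount-concatMap Q? rows xs))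

oddCount-cong : ∀ {P Q : Pred A 0ℓ} (P? : Decidable P) (Q? : Decidable Q) →
                (∀ x → P x ⇔ Q x) → ∀ xs → oddCount P? xs ≡ oddCount Q? xs
oddCount-cong P? Q? P⇔Q []       = refl
oddCount-cong P? Q? P⇔Q (x ∷ xs) =
  cong₂ _xor_ (does-⇔ (P⇔Q x) (P? x) (Q? x)) (oddCount-cong P? Q? P⇔Q xs)

oddCount-upTo-suc : ∀ {P : Pred ℕ 0ℓ} (P? : Decidable P) n →
                    oddCount P? (upTo (suc n)) ≡ does (P? 0) xor oddCount (P? ∘ suc) (upTo n)
oddCount-upTo-suc P? n =
  cong (does (P? 0) xor_)
       (trans (cong (oddCount P?) (sym (map-upTo suc n))) (oddCount-map P? suc (upTo n)))

oddCount-upTo-unique : ∀ {P : Pred ℕ 0ℓ} (P? : Decidable P) {N k₀} → k₀ ℕ.< N → P k₀ →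
                       (∀ {k} → P k → k ≡ k₀) → oddCount P? (upTo N) ≡ true
oddCount-upTo-unique P? {suc N} {zero} _ P0 unique =
  trans (oddCount-upTo-suc P? N)
        (cong₂ _xor_ (dec-true (P? 0) P0)
                     (oddCount-none (P? ∘ suc) (λ k → ℕP.0≢1+n ∘ sym ∘ unique) (upTo N)))
oddCount-upTo-unique P? {suc N} {suc k₀} (s<s k₀<N) Pk₀ unique =
  trans (oddCount-upTo-suc P? N)
        (cong₂ _xor_ (dec-false (P? 0) (ℕP.0≢1+n ∘ unique))
                     (oddCount-upTo-unique (P? ∘ suc) k₀<N Pk₀ (ℕP.suc-injective ∘ unique)))

oddCount-range : ∀ {P : Pred ℤ 0ℓ} (P? : Decidable P) n →
                 oddCount P? (range n) ≡
                 oddCount (P? ∘ +_) (upTo (suc n)) xor oddCount (P? ∘ -[1+_]) (upTo n)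
oddCount-range P? n =
  trans (oddCount-++ P? (map +_ (upTo (suc n))) (map -[1+_] (upTo n)))
        (cong₂ _xor_ (oddCount-map P? +_ (upTo (suc n))) (oddCount-map P? -[1+_] (upTo n)))

oddCount-range-symmetric : ∀ {P : Pred ℤ 0ℓ} (P? : Decidable P) → (∀ {y} → P y → P (- y)) →
                           ∀ n → oddCount P? (range n) ≡ does (P? (+ 0))
oddCount-range-symmetric {P} P? P-sym n = begin
  oddCount P? (range n)
    ≡⟨ oddCount-range P? n ⟩
  oddCount (P? ∘ +_) (upTo (suc n)) xor negatives
    ≡⟨ cong (_xor negatives) (oddCount-upTo-suc (P? ∘ +_) n) ⟩
  (does (P? (+ 0)) xor oddCount (λ k → P? (+ suc k)) (upTo n)) xor negatives
    ≡⟨ cong (λ b → (does (P? (+ 0)) xor b) xor negatives) positives≡negatives ⟩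
  (does (P? (+ 0)) xor negatives) xor negatives
    ≡⟨ xor-assoc (does (P? (+ 0))) negatives negatives ⟩
  does (P? (+ 0)) xor (negatives xor negatives)
    ≡⟨ cong (does (P? (+ 0)) xor_) (xor-same negatives) ⟩
  does (P? (+ 0)) xor false
    ≡⟨ xor-identityʳ (does (P? (+ 0))) ⟩
  does (P? (+ 0)) ∎
  where
  open ≡-Reasoning
  negatives = oddCount (P? ∘ -[1+_]) (upTo n)
  positives≡negatives : oddCount (λ k → P? (+ suc k)) (upTo n) ≡ negatives
  positives≡negatives =
    oddCount-cong (λ k → P? (+ suc k)) (P? ∘ -[1+_]) (λ _ → mk⇔ P-sym P-sym) (upTo n)

-- a s n unfolds to sum (c s) (normGens n).
sum : (A → ℤ√-3) → List A → ℤ√-3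
sum f = foldr (λ x acc → f x ⊕ acc) 𝟘

sum-cong : ∀ {f g : A → ℤ√-3} {xs} → All (λ x → f x ≡ g x) xs → sum f xs ≡ sum g xs
sum-cong []         = refl
sum-cong (eq ∷ eqs) = cong₂ _⊕_ eq (sum-cong eqs)

residue-sum-filter : ∀ {P : Pred A 0ℓ} (P? : Decidable P) {f : A → ℤ√-3} →
                     (∀ {x} → P x → residue (f x) ≡ true) →
                     ∀ xs → residue (sum f (filter P? xs)) ≡ oddCount P? xs
residue-sum-filter P? odd [] = refl
residue-sum-filter P? {f} odd (x ∷ xs) with P? x
... | yes Px = trans (residue-⊕ (f x) (sum f (filter P? xs)))
                     (cong₂ _xor_ (odd Px) (residue-sum-filter P? {f} odd xs))
... | no  _  = residue-sum-filter P? {f} odd xs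

a-plus≡a-minus : n % 4 ≡ 1 → a plus n ≡ a minus n
a-plus≡a-minus {n} n≡1 =
  sum-cong (All.map (λ {g} → c-plus≡c-minus {g = g} n≡1) (all-filter (normGen? n) (candidates n)))

realGenCount : ℕ → Bool
realGenCount n = oddCount (λ x → normGen? n (x , + 0)) (range n)

residue-a : ∀ s n → residue (a s n) ≡ realGenCount n
residue-a s n = begin
  residue (a s n)
    ≡⟨ residue-sum-filter (normGen? n) {c s} (λ {g} → residue-c s {n} {g}) (candidates n) ⟩
  oddCount (normGen? n) (candidates n)
    ≡⟨ oddCount-concatMap (normGen? n) (λ x → normGen? n (x , + 0)) {row-of} row (range n) ⟩
  realGenCount n ∎
  where
  open ≡-Reasoning
  row-of : ℤ → List (ℤ × ℤ)
  row-of x = map (λ y → x , y) (range n)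
  row : ∀ x → oddCount (normGen? n) (row-of x) ≡ does (normGen? n (x , + 0))
  row x = trans (oddCount-map (normGen? n) (λ y → x , y) (range n))
                (oddCount-range-symmetric (λ y → normGen? n (x , y))
                                          (λ {y} → NormGen-conj {n} {x} {y}) n)

^%≡1 : ∀ {m d} .{{_ : ℕ.NonZero d}} → m % d ≡ 1 → ∀ i → m ^ i % d ≡ 1
^%≡1 {m} {d} m≡1 zero    = m<n⇒m%n≡m (subst (ℕ._< d) m≡1 (m%n<n m d))
^%≡1 {m} {d} m≡1 (suc i) = begin
  m ℕ.* m ^ i % d              ≡⟨ %-distribˡ-* m (m ^ i) d ⟩
  (m % d) ℕ.* (m ^ i % d) % d  ≡⟨ cong₂ (λ r s → r ℕ.* s % d) m≡1 (^%≡1 m≡1 i) ⟩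
  1 % d                        ≡⟨ ^%≡1 m≡1 zero ⟩
  1                            ∎
  where open ≡-Reasoning

^-square : ∀ m i → m ^ i ℕ.* m ^ i ≡ m ^ (i ℕ.* 2)
^-square m i = trans (sym (ℕP.^-distribˡ-+-* m i i)) (cong (m ^_) (i+i≡i*2 i))
  where
  i+i≡i*2 : ∀ i → i ℕ.+ i ≡ i ℕ.* 2
  i+i≡i*2 = ℕ-Solver.solve-∀

prime∣square : ∀ {m} → Prime p → p ∣ m ℕ.* m → p ∣ m
prime∣square {m = m} pp p∣m² = reduce (euclidsLemma m m pp p∣m²)

prime-square-factor : ∀ {m} → Prime p → m ℕ.* m ≡ p ^ suc j →
                      ∃[ k ] m ≡ k ℕ.* p × k ℕ.* k ℕ.* p ≡ p ^ j
prime-square-factor {p} {j} {m} pp m²≡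
  with prime∣square {m = m} pp (divides (p ^ j) (trans m²≡ (ℕP.*-comm p (p ^ j))))
... | divides k refl = k , refl , ℕP.*-cancelˡ-≡ _ _ p {{prime⇒nonZero pp}} (trans (regroup k p) m²≡)
  where
  regroup : ∀ k p → p ℕ.* (k ℕ.* k ℕ.* p) ≡ k ℕ.* p ℕ.* (k ℕ.* p)
  regroup = ℕ-Solver.solve-∀

prime^-sqrt : ∀ {m} → Prime p → m ℕ.* m ≡ p ^ j → ∃[ i ] j ≡ i ℕ.* 2 × m ≡ p ^ i
prime^-sqrt {p} {zero} {m} _ m²≡1 = 0 , refl , ℕP.m*n≡1⇒n≡1 m m m²≡1
prime^-sqrt {p} {suc zero} {m} pp m²≡p with prime-square-factor {j = zero} {m = m} pp m²≡p
... | k , _ , k²p≡1 = contradiction (subst Prime (ℕP.m*n≡1⇒n≡1 (k ℕ.* k) p k²p≡1) pp) ¬prime[1]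
prime^-sqrt {p} {suc (suc j)} {m} pp m²≡ with prime-square-factor {j = suc j} {m = m} pp m²≡
... | k , refl , k²p≡
  with prime^-sqrt {j = j} {m = k} pp
         (ℕP.*-cancelʳ-≡ (k ℕ.* k) (p ^ j) p {{prime⇒nonZero pp}} (trans k²p≡ (ℕP.*-comm p (p ^ j))))
...   | i , refl , refl = suc i , refl , ℕP.*-comm (p ^ i) p

prime^-sqrt-unique : ∀ {i k} → Prime p → j ≡ i ℕ.* 2 → k ℕ.* k ≡ p ^ j → k ≡ p ^ i
prime^-sqrt-unique {p} {j} {i} {k} pp j≡i*2 k²≡p^j with prime^-sqrt {j = j} {m = k} pp k²≡p^j
... | i′ , j≡i′*2 , k≡p^i′ =
  trans k≡p^i′ (cong (p ^_) (ℕP.*-cancelʳ-≡ i′ i 2 (trans (sym j≡i′*2) j≡i*2)))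

NormGen-real⇒square : ∀ {n x} → NormGen n (x , + 0) → ∣ x ∣ ℕ.* ∣ x ∣ ≡ n
NormGen-real⇒square {n} {x} (norm≡n , _) =
  trans (sym (ℤP.abs-* x x)) (cong ∣_∣ (trans (sym (ℤP.+-identityʳ (x * x))) norm≡n))

-[1+k]%3≡2 : ∀ k → suc k % 3 ≡ 1 → -[1+ k ] ℤ.% + 3 ≡ 2
-[1+k]%3≡2 k 1+k≡1 rewrite 1+k≡1 = refl

realGenCount-p^odd : Prime p → j % 2 ≡ 1 → realGenCount (p ^ j) ≡ false
realGenCount-p^odd {p} {j} pp j-odd =
  oddCount-none (λ x → normGen? (p ^ j) (x , + 0)) no-root (range (p ^ j))
  where
  no-root : ∀ x → ¬ NormGen (p ^ j) (x , + 0)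
  no-root x g with prime^-sqrt {j = j} {m = ∣ x ∣} pp (NormGen-real⇒square {x = x} g)
  ... | i , j≡i*2 , _ =
    contradiction (trans (sym (m*n%n≡0 i 2)) (trans (cong (_% 2) (sym j≡i*2)) j-odd)) λ ()

realGenCount-p^even : Prime p → p % 2 ≡ 1 → p % 3 ≡ 1 → j % 2 ≡ 0 → realGenCount (p ^ j) ≡ true
realGenCount-p^even {p} {j} pp p-odd p≡1 j-even = begin
  oddCount G? (range N)
    ≡⟨ oddCount-range G? N ⟩
  oddCount (G? ∘ +_) (upTo (suc N)) xor oddCount (G? ∘ -[1+_]) (upTo N)
    ≡⟨ cong₂ _xor_ (oddCount-upTo-unique (G? ∘ +_) m<1+N root root-unique)
                   (oddCount-none (G? ∘ -[1+_]) no-negative-root (upTo N)) ⟩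
  true ∎
  where
  open ≡-Reasoning
  N = p ^ j
  i = j / 2
  m = p ^ i
  G? : Decidable (λ x → NormGen N (x , + 0))
  G? x = normGen? N (x , + 0)
  j≡i*2 : j ≡ i ℕ.* 2
  j≡i*2 = trans (m≡m%n+[m/n]*n j 2) (cong (ℕ._+ i ℕ.* 2) j-even)
  m*m≡N : m ℕ.* m ≡ N
  m*m≡N = trans (^-square p i) (cong (p ^_) (sym j≡i*2))
  m<1+N : m ℕ.< suc N
  m<1+N = s≤s (subst (m ℕ.≤_) m*m≡N (ℕP.m≤m*n m m {{ℕP.m^n≢0 p i {{prime⇒nonZero pp}}}}))
  root : NormGen N (+ m , + 0)
  root = trans (ℤP.+-identityʳ (+ m * + m)) (trans (sym (ℤP.pos-* m m)) (cong +_ m*m≡N)) ,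
         trans (cong (_% 2) (ℕP.+-identityʳ m)) (^%≡1 p-odd i) ,
         ^%≡1 p≡1 i
  root-unique : ∀ {k} → NormGen N (+ k , + 0) → k ≡ m
  root-unique {k} g = prime^-sqrt-unique {i = i} pp j≡i*2 (NormGen-real⇒square {x = + k} g)
  no-negative-root : ∀ k → ¬ NormGen N (-[1+ k ] , + 0)
  no-negative-root k g@(_ , _ , -1-k≡1) =
    contradiction (trans (sym -1-k≡1) (-[1+k]%3≡2 k 1+k≡1)) λ ()
    where
    1+k≡m : suc k ≡ m
    1+k≡m = prime^-sqrt-unique {i = i} pp j≡i*2 (NormGen-real⇒square {x = -[1+ k ]} g)
    1+k≡1 : suc k % 3 ≡ 1
    1+k≡1 = subst (λ t → t % 3 ≡ 1) (sym 1+k≡m) (^%≡1 {p} p≡1 i)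

lemma4p2 : (p : ℕ) → Prime p → p % 12 ≡ 1 → (j : ℕ) →
    (a plus (p ^ j) ≡ a minus (p ^ j))
    × (j % 2 ≡ 0 → a plus (p ^ j) ≡ 𝟙 [mod2])
    × (j % 2 ≡ 1 → a plus (p ^ j) ≡ 𝟘 [mod2])
lemma4p2 p pp p≡1 j = a-plus≡a-minus {p ^ j} (^%≡1 (p≡1-mod 4 (divides 3 refl)) j) , even , odd
  where
  p≡1-mod : ∀ d .{{_ : ℕ.NonZero d}} → d ∣ 12 → p % d ≡ 1 % d
  p≡1-mod d d∣12 = trans (sym (m∣n⇒o%n%m≡o%m d 12 p d∣12)) (cong (_% d) p≡1)
  even : j % 2 ≡ 0 → a plus (p ^ j) ≡ 𝟙 [mod2]
  even j-even = residue⇒≡[mod2] {a plus (p ^ j)} {𝟙} (trans (residue-a plus (p ^ j))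
    (realGenCount-p^even {j = j} pp (p≡1-mod 2 (divides 6 refl)) (p≡1-mod 3 (divides 4 refl)) j-even))
  odd : j % 2 ≡ 1 → a plus (p ^ j) ≡ 𝟘 [mod2]
  odd j-odd = residue⇒≡[mod2] {a plus (p ^ j)} {𝟘}
    (trans (residue-a plus (p ^ j)) (realGenCount-p^odd {j = j} pp j-odd))
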